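{- There exist two finite, connected, bipartite graphs $G$ and $H$, each of diameter $3$, such that $G$ and $H$ are not isomorphic but $|\mathrm{Hom}(G,T)| = |\mathrm{Hom}(H,T)|$ for every finite tree $T$.
   Context: All graphs are finite, simple and undirected. $\mathrm{Hom}(G,H)$ denotes the set of graph homomorphisms from $G$ to $H$, i.e. maps $f:V(G)\to V(H)$ sending every edge of $G$ to an edge of $H$. A tree is a connected graph with no cycles. The diameter of a connected graph is the least $p$ such that any two distinct vertices are joined by a path of length at most $p$. -}

module Defs where

open import Data.Nat using (ℕ; zero; suc; _≤_)
open import Data.Fin using (Fin; zero; suc)
open import Data.Bool using (Bool; true; false; T; _∧_; not; _∨_)
open import Data.List using (List; []; _∷_; [_]; map; concatMap; length; filter; allFin)
open import Data.Bool.ListAction using (all)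
open import Data.Vec using (Vec; lookup; head; last)
open import Data.Product using (Σ; ∃; ∃-syntax; _×_; _,_)
open import Relation.Binary.PropositionalEquality using (_≡_; _≢_)
open import Relation.Nullary using (¬_)
open import Relation.Nullary.Decidable using (does)
open import Function.Definitions using (Injective)

record Graph : Set where
  field
    size   : ℕ
    adj    : Fin size → Fin size → Bool
    adj-sym    : ∀ i j → adj i j ≡ adj j i
    adj-irrefl : ∀ i → adj i i ≡ false

open Graph public

Vertex : Graph → Set
Vertex G = Fin (size G)

Adj : (G : Graph) → Vertex G → Vertex G → Set
Adj G u v = T (adj G u v)

record Path (G : Graph) (k : ℕ) (u v : Vertex G) : Set where
  field
    verts    : Vec (Vertex G) (suc k)
    distinct : Injective _≡_ _≡_ (lookup verts)
    steps    : (i : Fin k) → Adj G (lookup verts (Data.Fin.inject₁ i)) (lookup verts (suc i))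
    start    : head verts ≡ u
    end      : last verts ≡ v

Connected : Graph → Set
Connected G = ∀ (u v : Vertex G) → ∃[ k ] Path G k u v

DiamAtMost : Graph → ℕ → Set
DiamAtMost G p = ∀ (u v : Vertex G) → u ≢ v → ∃[ k ] (k ≤ p × Path G k u v)

HasDiameter : Graph → ℕ → Set
HasDiameter G zero    = DiamAtMost G zero
HasDiameter G (suc p) = DiamAtMost G (suc p) × ¬ DiamAtMost G p

Bipartite : Graph → Set
Bipartite G = Σ (Vertex G → Bool) λ c → ∀ u v → Adj G u v → c u ≢ c v

-- A cycle of length k+1 ≥ 3: distinct vertices v₀ … v_k, consecutive adjacent, v_k ~ v₀.
record Cycle (G : Graph) (k : ℕ) : Set where
  field
    long     : 2 ≤ k
    verts    : Vec (Vertex G) (suc k)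
    distinct : Injective _≡_ _≡_ (lookup verts)
    steps    : (i : Fin k) → Adj G (lookup verts (Data.Fin.inject₁ i)) (lookup verts (suc i))
    closing  : Adj G (last verts) (head verts)

Acyclic : Graph → Set
Acyclic G = ∀ k → ¬ Cycle G k

IsTree : Graph → Set
IsTree G = Connected G × Acyclic G

Isomorphic : Graph → Graph → Set
Isomorphic G H =
  Σ (Vertex G → Vertex H) λ f → Σ (Vertex H → Vertex G) λ g →
    (∀ x → g (f x) ≡ x) × (∀ y → f (g y) ≡ y) × (∀ u v → adj H (f u) (f v) ≡ adj G u v)

allMaps : (n m : ℕ) → List (Fin n → Fin m)
allMaps zero    m = [ (λ ()) ]
allMaps (suc n) m = concatMap (λ f → map (λ x → cons x f) (allFin m)) (allMaps n m)
  where
  cons : Fin m → (Fin n → Fin m) → Fin (suc n) → Fin m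
  cons x f zero    = x
  cons x f (suc i) = f i

isHom : (G H : Graph) → (Vertex G → Vertex H) → Bool
isHom G H f = all (λ u → all (λ v → not (adj G u v) ∨ adj H (f u) (f v)) (allFin (size G))) (allFin (size G))

homCount : Graph → Graph → ℕ
homCount G H = length (filter (λ f → Data.Bool._≟_ (isHom G H f) true) (allMaps (size G) (size H)))

{-# OPTIONS --safe #-}
-- G and H share eleven edges and differ in a twelfth: 3–6 in G, 3–5 in H. Let f map the vertices
-- into a tree. If f glues 3 to 0, the two extra edges are mapped like the common edges 0–6 and 0–5,
-- so f is a homomorphism of G iff it is one of H. Otherwise f glues the two common neighbours 4
-- and 7 of 0 and 3, since a tree has no 4-cycle; then f is a homomorphism of H iff f ∘ ψ is one
-- of G, where ψ swaps 1 ↔ 2 and 5 ↔ 6. Precomposition with ψ permutes the maps being counted and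
-- respects gluing, so the counts agree. G has an edge joining two vertices of degree 2 and H has
-- none, so G and H are not isomorphic.
module Submission where

open import Defs
open import Data.Bool using (Bool; true; false; T; _∧_; _∨_; not; if_then_else_)
open import Data.Bool.ListAction using (all; any; or)
open import Data.Bool.Properties using (∨-comm; T-≡; ⇔→≡) renaming (_≟_ to _≟ᵇ_)
open import Data.Empty using (⊥-elim)
open import Data.Fin using (Fin; zero; suc; #_; lift; inject₁; toℕ)
open import Data.Fin.Properties using (_≟_; all?; any?)
open import Data.List using (List; []; _∷_; map; concatMap; allFin; filter; length; _++_)
open import Data.List.Properties using (map-cong; map-++; map-∘)
open import Data.List.Membership.Propositional.Properties using (∈-allFin)
open import Data.List.Relation.Unary.All as All using (All; []; _∷_)
open import Data.List.Relation.Unary.All.Properties using (all⁺; all⁻)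
open import Data.List.Relation.Unary.Any as Any using ()
open import Data.List.Relation.Unary.Any.Properties using (any⁺; any⁻)
open import Data.Nat using (ℕ; zero; suc; _+_; _≤_; z≤n; s≤s; _<ᵇ_)
open import Data.Nat.ListAction using (sum)
open import Data.Nat.ListAction.Properties using (sum-++)
open import Data.Nat.Properties using (+-identityʳ; +-commutativeSemigroup)
open import Algebra.Properties.CommutativeSemigroup +-commutativeSemigroup using (interchange)
open import Data.Product using (Σ; ∃-syntax; _×_; _,_; proj₁; proj₂)
open import Data.Sum using (_⊎_; inj₁; inj₂) renaming (map to ⊎-map)
open import Data.Vec using (Vec; []; _∷_; lookup; head; last)
open import Data.Vec.Functional using () renaming (_∷_ to _∷ᶠ_)
open import Data.Vec.Relation.Unary.All using ([]; _∷_)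
open import Data.Vec.Relation.Unary.AllPairs using ([]; _∷_; allPairs?)
open import Data.Vec.Relation.Unary.Linked using (Linked; []; [-]; _∷_; linked?)
open import Data.Vec.Relation.Unary.Unique.Propositional using (Unique)
open import Data.Vec.Relation.Unary.Unique.Propositional.Properties using (lookup-injective)
open import Function using (_∘_; _⇔_; mk⇔; Equivalence)
open import Function.Construct.Composition using (_⇔-∘_)
open import Function.Construct.Symmetry using (⇔-sym)
open import Relation.Binary.PropositionalEquality
  using (_≡_; _≢_; _≗_; refl; sym; trans; cong; cong₂; subst; subst₂; module ≡-Reasoning)
open import Relation.Nullary using (¬_; Dec; yes; no; does; ¬?)
open import Relation.Nullary.Decidable using (T?; from-yes; from-no; _×-dec_; _⊎-dec_; _→-dec_)

open Equivalence using (to; from)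

∑ : {A : Set} → List A → (A → ℕ) → ℕ
∑ xs F = sum (map F xs)

module _ {A : Set} where

  ∑-cong : {F G : A → ℕ} → F ≗ G → ∀ xs → ∑ xs F ≡ ∑ xs G
  ∑-cong F≗G xs = cong sum (map-cong F≗G xs)

  ∑-++ : (F : A → ℕ) (xs ys : List A) → ∑ (xs ++ ys) F ≡ ∑ xs F + ∑ ys F
  ∑-++ F xs ys = trans (cong sum (map-++ F xs ys)) (sum-++ (map F xs) (map F ys))

  ∑-+ : (F G : A → ℕ) (xs : List A) → ∑ xs (λ x → F x + G x) ≡ ∑ xs F + ∑ xs G
  ∑-+ F G []       = refl
  ∑-+ F G (x ∷ xs) = trans (cong (F x + G x +_) (∑-+ F G xs)) (interchange (F x) (G x) _ _)

  ∑-zero : (xs : List A) → ∑ xs (λ _ → 0) ≡ 0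
  ∑-zero []       = refl
  ∑-zero (x ∷ xs) = ∑-zero xs

module _ {A B : Set} where

  ∑-map : (F : B → ℕ) (h : A → B) (xs : List A) → ∑ (map h xs) F ≡ ∑ xs (F ∘ h)
  ∑-map F h xs = cong sum (sym (map-∘ xs))

  ∑-concatMap : (F : B → ℕ) (g : A → List B) (xs : List A) →
                ∑ (concatMap g xs) F ≡ ∑ xs (λ a → ∑ (g a) F)
  ∑-concatMap F g []       = refl
  ∑-concatMap F g (x ∷ xs) =
    trans (∑-++ F (g x) (concatMap g xs)) (cong (∑ (g x) F +_) (∑-concatMap F g xs))

  ∑-comm : (F : A → B → ℕ) (xs : List A) (ys : List B) →
           ∑ xs (λ x → ∑ ys (F x)) ≡ ∑ ys (λ y → ∑ xs (λ x → F x y))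
  ∑-comm F []       ys = sym (∑-zero ys)
  ∑-comm F (x ∷ xs) ys = trans (cong (∑ ys (F x) +_) (∑-comm F xs ys)) (sym (∑-+ (F x) _ ys))

𝟙 : Bool → ℕ
𝟙 true  = 1
𝟙 false = 0

𝟙-split : ∀ c a → 𝟙 a ≡ 𝟙 (c ∧ a) + 𝟙 (not c ∧ a)
𝟙-split true  a = sym (+-identityʳ (𝟙 a))
𝟙-split false a = refl

𝟙-if : ∀ c a b → 𝟙 (if c then a else b) ≡ 𝟙 (c ∧ a) + 𝟙 (not c ∧ b)
𝟙-if true  a b = sym (+-identityʳ (𝟙 a))
𝟙-if false a b = refl

length-filter≡∑𝟙 : {A : Set} (p : A → Bool) (xs : List A) →
                   length (filter (λ x → p x ≟ᵇ true) xs) ≡ ∑ xs (𝟙 ∘ p)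
length-filter≡∑𝟙 p []       = refl
length-filter≡∑𝟙 p (x ∷ xs) with p x
... | true  = cong suc (length-filter≡∑𝟙 p xs)
... | false = length-filter≡∑𝟙 p xs

∑-switch : {A : Set} (φ : A → A) (D p q : A → Bool) (xs : List A) →
           ∑ xs (λ x → 𝟙 (not (D x) ∧ p x)) ≡ ∑ xs (λ x → 𝟙 (not (D (φ x)) ∧ p (φ x))) →
           (∀ x → D (φ x) ≡ D x) →
           (∀ x → q x ≡ (if D x then p x else p (φ x))) →
           ∑ xs (𝟙 ∘ q) ≡ ∑ xs (𝟙 ∘ p)
∑-switch {A} φ D p q xs invariant Dφ≡D q≡ = begin
    ∑ xs (𝟙 ∘ q)
  ≡⟨ ∑-cong (λ x → trans (cong 𝟙 (q≡ x)) (𝟙-if (D x) (p x) (p (φ x)))) xs ⟩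
    ∑ xs (λ x → 𝟙 (D x ∧ p x) + 𝟙 (not (D x) ∧ p (φ x)))
  ≡⟨ ∑-+ _ _ xs ⟩
    ∑ xs Dp + ∑ xs (λ x → 𝟙 (not (D x) ∧ p (φ x)))
  ≡⟨ cong (∑ xs Dp +_) (∑-cong (λ x → cong (λ d → 𝟙 (not d ∧ p (φ x))) (sym (Dφ≡D x))) xs) ⟩
    ∑ xs Dp + ∑ xs (λ x → 𝟙 (not (D (φ x)) ∧ p (φ x)))
  ≡⟨ cong (∑ xs Dp +_) (sym invariant) ⟩
    ∑ xs Dp + ∑ xs (λ x → 𝟙 (not (D x) ∧ p x))
  ≡⟨ sym (∑-+ _ _ xs) ⟩
    ∑ xs (λ x → 𝟙 (D x ∧ p x) + 𝟙 (not (D x) ∧ p x))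
  ≡⟨ sym (∑-cong (λ x → 𝟙-split (D x) (p x)) xs) ⟩
    ∑ xs (𝟙 ∘ p)
  ∎
  where
  open ≡-Reasoning
  Dp : A → ℕ
  Dp x = 𝟙 (D x ∧ p x)

Extensional : {n m : ℕ} → ((Fin n → Fin m) → ℕ) → Set
Extensional F = ∀ {f g} → f ≗ g → F f ≡ F g

∷ᶠ-cong : ∀ {n m} (x : Fin m) {f g : Fin n → Fin m} → f ≗ g → (x ∷ᶠ f) ≗ (x ∷ᶠ g)
∷ᶠ-cong x f≗g zero    = refl
∷ᶠ-cong x f≗g (suc i) = f≗g i

∑-allMaps-suc : ∀ {n m} (F : (Fin (suc n) → Fin m) → ℕ) → Extensional F →
                ∑ (allMaps (suc n) m) F ≡ ∑ (allMaps n m) (λ f → ∑ (allFin m) (λ x → F (x ∷ᶠ f)))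
∑-allMaps-suc {n} {m} F F-ext =
  trans (∑-concatMap F _ (allMaps n m))
        (∑-cong (λ f → trans (∑-map F _ (allFin m))
                             (∑-cong (λ x → F-ext (λ { zero → refl ; (suc i) → refl })) (allFin m)))
                (allMaps n m))

SumInvariant : ∀ {n} → (Fin n → Fin n) → Set
SumInvariant {n} σ = ∀ {m} (F : (Fin n → Fin m) → ℕ) → Extensional F →
                     ∑ (allMaps n m) F ≡ ∑ (allMaps n m) (λ f → F (f ∘ σ))

∘-invariant : ∀ {n} {σ τ : Fin n → Fin n} → SumInvariant σ → SumInvariant τ → SumInvariant (σ ∘ τ)
∘-invariant {τ = τ} σ-inv τ-inv F F-ext =
  trans (τ-inv F F-ext) (σ-inv (λ f → F (f ∘ τ)) (λ f≗g → F-ext (f≗g ∘ τ)))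

swap₀₁ : ∀ {n} → Fin (suc (suc n)) → Fin (suc (suc n))
swap₀₁ zero          = suc zero
swap₀₁ (suc zero)    = zero
swap₀₁ (suc (suc i)) = suc (suc i)

-- Fubini over the first two coordinates.
swap₀₁-invariant : ∀ {n} → SumInvariant (swap₀₁ {n})
swap₀₁-invariant {n} {m} F F-ext = begin
    ∑ (allMaps (suc (suc n)) m) F
  ≡⟨ unfold₂ F F-ext ⟩
    ∑ (allMaps n m) (λ f → ∑ xs (λ y → ∑ xs (λ x → F (x ∷ᶠ y ∷ᶠ f))))
  ≡⟨ ∑-cong (λ f → ∑-comm (λ y x → F (x ∷ᶠ y ∷ᶠ f)) xs xs) (allMaps n m) ⟩
    ∑ (allMaps n m) (λ f → ∑ xs (λ x → ∑ xs (λ y → F (x ∷ᶠ y ∷ᶠ f))))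
  ≡⟨ ∑-cong (λ f → ∑-cong (λ y → ∑-cong (λ x → F-ext (swapped x y f)) xs) xs) (allMaps n m) ⟩
    ∑ (allMaps n m) (λ f → ∑ xs (λ y → ∑ xs (λ x → F ((x ∷ᶠ y ∷ᶠ f) ∘ swap₀₁))))
  ≡⟨ sym (unfold₂ (λ f → F (f ∘ swap₀₁)) (λ f≗g → F-ext (f≗g ∘ swap₀₁))) ⟩
    ∑ (allMaps (suc (suc n)) m) (λ f → F (f ∘ swap₀₁))
  ∎
  where
  open ≡-Reasoning
  xs : List (Fin m)
  xs = allFin m

  unfold₂ : (G : (Fin (suc (suc n)) → Fin m) → ℕ) → Extensional G →
            ∑ (allMaps (suc (suc n)) m) G ≡
            ∑ (allMaps n m) (λ f → ∑ xs (λ y → ∑ xs (λ x → G (x ∷ᶠ y ∷ᶠ f))))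
  unfold₂ G G-ext = trans (∑-allMaps-suc G G-ext)
                          (∑-allMaps-suc _ (λ f≗g → ∑-cong (λ x → G-ext (∷ᶠ-cong x f≗g)) xs))

  swapped : ∀ x y (f : Fin n → Fin m) → (y ∷ᶠ x ∷ᶠ f) ≗ ((x ∷ᶠ y ∷ᶠ f) ∘ swap₀₁)
  swapped x y f zero          = refl
  swapped x y f (suc zero)    = refl
  swapped x y f (suc (suc i)) = refl

lift-invariant : ∀ {n} k {σ : Fin n → Fin n} → SumInvariant σ → SumInvariant (lift k σ)
lift-invariant zero    σ-inv = σ-inv
lift-invariant {n} (suc k) {σ} σ-inv {m} F F-ext = begin
    ∑ (allMaps (suc (k + n)) m) F
  ≡⟨ ∑-allMaps-suc F F-ext ⟩
    ∑ (allMaps (k + n) m) (λ f → ∑ xs (λ x → F (x ∷ᶠ f)))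
  ≡⟨ lift-invariant k σ-inv _ (λ f≗g → ∑-cong (λ x → F-ext (∷ᶠ-cong x f≗g)) xs) ⟩
    ∑ (allMaps (k + n) m) (λ f → ∑ xs (λ x → F (x ∷ᶠ (f ∘ lift k σ))))
  ≡⟨ ∑-cong (λ f → ∑-cong (λ x → F-ext (λ { zero → refl ; (suc i) → refl })) xs) (allMaps (k + n) m) ⟩
    ∑ (allMaps (k + n) m) (λ f → ∑ xs (λ x → F ((x ∷ᶠ f) ∘ lift (suc k) σ)))
  ≡⟨ sym (∑-allMaps-suc (λ f → F (f ∘ lift (suc k) σ)) (λ f≗g → F-ext (f≗g ∘ lift (suc k) σ))) ⟩
    ∑ (allMaps (suc (k + n)) m) (λ f → F (f ∘ lift (suc k) σ))
  ∎
  where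
  open ≡-Reasoning
  xs : List (Fin m)
  xs = allFin m

module _ (X : Graph) where

  adj-symmetric : ∀ {u v} → Adj X u v → Adj X v u
  adj-symmetric {u} {v} = subst T (adj-sym X u v)

  adj⇒≢ : ∀ {u v} → Adj X u v → u ≢ v
  adj⇒≢ {u} u~u refl = subst T (adj-irrefl X u) u~u

linked-steps : ∀ {A : Set} {R : A → A → Set} {k} {vs : Vec A (suc k)} → Linked R vs →
               (i : Fin k) → R (lookup vs (inject₁ i)) (lookup vs (suc i))
linked-steps {vs = _ ∷ _ ∷ _} (r ∷ _)  zero    = r
linked-steps {vs = _ ∷ _ ∷ _} (_ ∷ rs) (suc i) = linked-steps rs i

module _ (X : Graph) where

  vecPath : ∀ {k} (vs : Vec (Vertex X) (suc k)) → Unique vs → Linked (Adj X) vs →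
            Path X k (head vs) (last vs)
  vecPath vs distinct walk = record
    { verts    = vs
    ; distinct = λ {i} {j} → lookup-injective distinct i j
    ; steps    = linked-steps walk
    ; start    = refl
    ; end      = refl
    }

  PathVec : ∀ {n} → Vec (Vertex X) n → Set
  PathVec vs = Unique vs × Linked (Adj X) vs

  pathVec? : ∀ {n} (vs : Vec (Vertex X) n) → Dec (PathVec vs)
  pathVec? vs = allPairs? (λ a b → ¬? (a ≟ b)) vs ×-dec linked? (λ a b → T? (adj X a b)) vs

  ShortRoute : Vertex X → Vertex X → Set
  ShortRoute u v = PathVec (u ∷ v ∷ [])
                 ⊎ ∃[ w ] PathVec (u ∷ w ∷ v ∷ [])
                 ⊎ ∃[ w ] ∃[ x ] PathVec (u ∷ w ∷ x ∷ v ∷ [])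

  shortRoute? : ∀ u v → Dec (ShortRoute u v)
  shortRoute? u v = pathVec? _
              ⊎-dec any? (λ w → pathVec? _)
              ⊎-dec any? (λ w → any? (λ x → pathVec? _))

  shortRoute⇒path : ∀ {u v} → ShortRoute u v → ∃[ k ] (k ≤ 3 × Path X k u v)
  shortRoute⇒path (inj₁ (d , l))                 = 1 , s≤s z≤n , vecPath _ d l
  shortRoute⇒path (inj₂ (inj₁ (_ , d , l)))      = 2 , s≤s (s≤s z≤n) , vecPath _ d l
  shortRoute⇒path (inj₂ (inj₂ (_ , _ , d , l)))  = 3 , s≤s (s≤s (s≤s z≤n)) , vecPath _ d l

  FarApart : Vertex X → Vertex X → Set
  FarApart u v = u ≢ v × ¬ Adj X u v × (∀ w → ¬ (Adj X u w × Adj X w v))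

  farApart? : ∀ u v → Dec (FarApart u v)
  farApart? u v = ¬? (u ≟ v)
            ×-dec ¬? (T? (adj X u v))
            ×-dec all? (λ w → ¬? (T? (adj X u w) ×-dec T? (adj X w v)))

  farApart⇒noShortPath : ∀ {u v k} → FarApart u v → k ≤ 2 → ¬ Path X k u v
  farApart⇒noShortPath (u≢u , _ , _) _
    record { verts = _ ∷ [] ; start = refl ; end = refl } = u≢u refl
  farApart⇒noShortPath (_ , ¬u~v , _) _
    record { verts = _ ∷ _ ∷ [] ; steps = s ; start = refl ; end = refl } = ¬u~v (s zero)
  farApart⇒noShortPath (_ , _ , ¬u~w~v) _
    record { verts = _ ∷ w ∷ _ ∷ [] ; steps = s ; start = refl ; end = refl } =
    ¬u~w~v w (s zero , s (suc zero))
  farApart⇒noShortPath _ (s≤s (s≤s ())) record { verts = _ ∷ _ ∷ _ ∷ _ ∷ _ }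

  hasDiameter3 : (∀ u v → u ≢ v → ShortRoute u v) → ∀ {u v} → FarApart u v → HasDiameter X 3
  hasDiameter3 routes {u} {v} far =
      (λ a b a≢b → shortRoute⇒path (routes a b a≢b))
    , (λ diam → let _ , k≤2 , path = diam u v (proj₁ far) in farApart⇒noShortPath far k≤2 path)

  diamAtMost⇒connected : ∀ {p} → DiamAtMost X p → Connected X
  diamAtMost⇒connected diam u v with u ≟ v
  ... | yes refl = 0 , vecPath (u ∷ []) ([] ∷ []) [-]
  ... | no u≢v   = let k , _ , path = diam u v u≢v in k , path

  properColouring? : (c : Vertex X → Bool) → Dec (∀ u v → Adj X u v → c u ≢ c v)
  properColouring? c = all? (λ u → all? (λ v → T? (adj X u v) →-dec ¬? (c u ≟ᵇ c v)))

  AtMostTwoNeighbours : Vertex X → Set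
  AtMostTwoNeighbours u = ∀ a b c → Adj X u a → Adj X u b → Adj X u c → a ≡ b ⊎ a ≡ c ⊎ b ≡ c

  LowDegreeEdge : Set
  LowDegreeEdge = ∃[ u ] ∃[ v ] Adj X u v × AtMostTwoNeighbours u × AtMostTwoNeighbours v

  lowDegreeEdge? : Dec LowDegreeEdge
  lowDegreeEdge? = any? (λ u → any? (λ v → T? (adj X u v) ×-dec atMostTwo? u ×-dec atMostTwo? v))
    where
    atMostTwo? : ∀ u → Dec (AtMostTwoNeighbours u)
    atMostTwo? u = all? λ a → all? λ b → all? λ c →
      T? (adj X u a) →-dec T? (adj X u b) →-dec T? (adj X u c) →-dec (a ≟ b ⊎-dec a ≟ c ⊎-dec b ≟ c)

Isomorphic⇒LowDegreeEdge : ∀ {X Y} → Isomorphic X Y → LowDegreeEdge X → LowDegreeEdge Y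
Isomorphic⇒LowDegreeEdge {X} {Y} (f , g , _ , fg , pres) (u , v , u~v , u≤2 , v≤2) =
  f u , f v , subst T (sym (pres u v)) u~v , transport u≤2 , transport v≤2
  where
  pull : ∀ {u w} → Adj Y (f u) w → Adj X u (g w)
  pull {u} {w} = subst T (trans (cong (adj Y (f u)) (sym (fg w))) (pres u (g w)))

  g-injective : ∀ {a b} → g a ≡ g b → a ≡ b
  g-injective {a} {b} ga≡gb = trans (sym (fg a)) (trans (cong f ga≡gb) (fg b))

  transport : ∀ {u} → AtMostTwoNeighbours X u → AtMostTwoNeighbours Y (f u)
  transport ≤2 a b c a~ b~ c~ =
    ⊎-map g-injective (⊎-map g-injective g-injective)
          (≤2 (g a) (g b) (g c) (pull a~) (pull b~) (pull c~))

common-neighbour-unique : (Y : Graph) → Acyclic Y → ∀ {x y a b} → x ≢ y →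
                          Adj Y x a → Adj Y a y → Adj Y x b → Adj Y b y → a ≡ b
common-neighbour-unique Y acyclic {x} {y} {a} {b} x≢y x~a a~y x~b b~y with a ≟ b
... | yes a≡b = a≡b
... | no a≢b  = ⊥-elim (acyclic 3 square)
  where
  distinct : Unique (x ∷ a ∷ y ∷ b ∷ [])
  distinct = (adj⇒≢ Y x~a ∷ x≢y ∷ adj⇒≢ Y x~b ∷ [])
           ∷ (adj⇒≢ Y a~y ∷ a≢b ∷ [])
           ∷ (adj⇒≢ Y (adj-symmetric Y b~y) ∷ [])
           ∷ [] ∷ []

  square : Cycle Y 3
  square = record
    { long     = s≤s (s≤s z≤n)
    ; verts    = x ∷ a ∷ y ∷ b ∷ []
    ; distinct = λ {i} {j} → lookup-injective distinct i j
    ; steps    = linked-steps {R = Adj Y} (x~a ∷ a~y ∷ adj-symmetric Y b~y ∷ [-])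
    ; closing  = adj-symmetric Y x~b
    }

IsHom : (X Y : Graph) → (Vertex X → Vertex Y) → Set
IsHom X Y f = ∀ u v → Adj X u v → Adj Y (f u) (f v)

T-implication : ∀ {a b} → T (not a ∨ b) ⇔ (T a → T b)
T-implication {false} = mk⇔ (λ _ ()) (λ _ → _)
T-implication {true}  = mk⇔ (λ b _ → b) (λ h → h _)

isHom⇔IsHom : (X Y : Graph) (f : Vertex X → Vertex Y) → T (isHom X Y f) ⇔ IsHom X Y f
isHom⇔IsHom X Y f = mk⇔
  (λ h u v → to T-implication
     (All.lookup (all⁺ (pairOk u) vs (All.lookup (all⁺ rowOk vs h) (∈-allFin u))) (∈-allFin v)))
  (λ h → all⁻ rowOk {xs = vs} (All.tabulate λ {u} _ →
           all⁻ (pairOk u) {xs = vs} (All.tabulate λ {v} _ → from T-implication (h u v))))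
  where
  vs : List (Vertex X)
  vs = allFin (size X)

  pairOk : Vertex X → Vertex X → Bool
  pairOk u v = not (adj X u v) ∨ adj Y (f u) (f v)

  rowOk : Vertex X → Bool
  rowOk u = all (pairOk u) vs

isHom-≡ : ∀ X X' Y (f : Vertex X → Vertex Y) (f' : Vertex X' → Vertex Y) →
          IsHom X Y f ⇔ IsHom X' Y f' → isHom X Y f ≡ isHom X' Y f'
isHom-≡ X X' Y f f' e =
  ⇔→≡ {z = true}
    (T-≡ ⇔-∘ (⇔-sym (isHom⇔IsHom X' Y f') ⇔-∘ (e ⇔-∘ (isHom⇔IsHom X Y f ⇔-∘ ⇔-sym T-≡))))

isHom-cong : ∀ X Y {f g : Vertex X → Vertex Y} → f ≗ g → isHom X Y f ≡ isHom X Y g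
isHom-cong X Y {f} {g} f≗g = isHom-≡ X X Y f g (mk⇔
  (λ h u v u~v → subst₂ (Adj Y) (f≗g u) (f≗g v) (h u v u~v))
  (λ h u v u~v → subst₂ (Adj Y) (sym (f≗g u)) (sym (f≗g v)) (h u v u~v)))

module _ {n : ℕ} where

  joins : Fin n × Fin n → Fin n → Fin n → Bool
  joins (a , b) u v = (does (a ≟ u) ∧ does (b ≟ v)) ∨ (does (a ≟ v) ∧ does (b ≟ u))

  joins-sym : ∀ e u v → joins e u v ≡ joins e v u
  joins-sym (a , b) u v = ∨-comm (does (a ≟ u) ∧ does (b ≟ v)) _

  joins-loop : ∀ {a b} → a ≢ b → ∀ u → joins (a , b) u u ≡ false
  joins-loop {a} {b} a≢b u with a ≟ u | b ≟ u
  ... | yes refl | yes refl = ⊥-elim (a≢b refl)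
  ... | yes _    | no _     = refl
  ... | no _     | _        = refl

  joins-ends : ∀ a b → T (joins (a , b) a b)
  joins-ends a b with a ≟ a | b ≟ b
  ... | yes _ | yes _ = _
  ... | no a≢a | _    = ⊥-elim (a≢a refl)
  ... | yes _ | no b≢b = ⊥-elim (b≢b refl)

  joins-reflects : ∀ {a b u v} → T (joins (a , b) u v) → (a ≡ u × b ≡ v) ⊎ (a ≡ v × b ≡ u)
  joins-reflects {a} {b} {u} {v} j with a ≟ u | b ≟ v | a ≟ v | b ≟ u
  ... | yes a≡u | yes b≡v | _       | _       = inj₁ (a≡u , b≡v)
  ... | yes _   | no _    | yes a≡v | yes b≡u = inj₂ (a≡v , b≡u)
  ... | no _    | _       | yes a≡v | yes b≡u = inj₂ (a≡v , b≡u)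

  Loopless : List (Fin n × Fin n) → Set
  Loopless = All (λ e → proj₁ e ≢ proj₂ e)

  loopless? : (es : List (Fin n × Fin n)) → Dec (Loopless es)
  loopless? = All.all? (λ e → ¬? (proj₁ e ≟ proj₂ e))

  no-loop : ∀ {es} → Loopless es → ∀ u → any (λ e → joins e u u) es ≡ false
  no-loop []           u = refl
  no-loop (a≢b ∷ rest) u = cong₂ _∨_ (joins-loop a≢b u) (no-loop rest u)

fromEdges : (n : ℕ) (es : List (Fin n × Fin n)) → Loopless es → Graph
fromEdges n es loopless = record
  { size       = n
  ; adj        = λ u v → any (λ e → joins e u v) es
  ; adj-sym    = λ u v → cong or (map-cong (λ e → joins-sym e u v) es)
  ; adj-irrefl = no-loop loopless
  }

EdgeHom : ∀ {n} (Y : Graph) → List (Fin n × Fin n) → (Fin n → Vertex Y) → Set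
EdgeHom Y es f = All (λ e → Adj Y (f (proj₁ e)) (f (proj₂ e))) es

fromEdges-IsHom : ∀ {n es} (loopless : Loopless es) Y (f : Fin n → Vertex Y) →
                  IsHom (fromEdges n es loopless) Y f ⇔ EdgeHom Y es f
fromEdges-IsHom {n} {es} loopless Y f = mk⇔
  (λ h → All.tabulate λ {(a , b)} ab∈es → h a b (any⁺ _ (Any.map (λ { refl → joins-ends a b }) ab∈es)))
  (λ h u v u~v → All.lookupWith (λ fe je → edge (joins-reflects je) fe) h (any⁻ _ es u~v))
  where
  edge : ∀ {a b u v} → (a ≡ u × b ≡ v) ⊎ (a ≡ v × b ≡ u) → Adj Y (f a) (f b) → Adj Y (f u) (f v)
  edge (inj₁ (refl , refl)) fa~fb = fa~fb
  edge (inj₂ (refl , refl)) fa~fb = adj-symmetric Y fa~fb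

fromEdges-isHom-≡ : ∀ {n es es'} (l : Loopless es) (l' : Loopless es') Y (f f' : Fin n → Vertex Y) →
                    EdgeHom Y es f ⇔ EdgeHom Y es' f' →
                    isHom (fromEdges n es l) Y f ≡ isHom (fromEdges n es' l') Y f'
fromEdges-isHom-≡ l l' Y f f' e =
  isHom-≡ (fromEdges _ _ l) (fromEdges _ _ l') Y f f'
    (⇔-sym (fromEdges-IsHom l' Y f') ⇔-∘ (e ⇔-∘ fromEdges-IsHom l Y f))

commonEdges : List (Fin 8 × Fin 8)
commonEdges = (# 0 , # 4) ∷ (# 0 , # 5) ∷ (# 0 , # 6) ∷ (# 0 , # 7)
            ∷ (# 1 , # 4) ∷ (# 1 , # 6) ∷ (# 1 , # 7)
            ∷ (# 2 , # 4) ∷ (# 2 , # 5)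
            ∷ (# 3 , # 4) ∷ (# 3 , # 7) ∷ []

edgesG edgesH : List (Fin 8 × Fin 8)
edgesG = (# 3 , # 6) ∷ commonEdges
edgesH = (# 3 , # 5) ∷ commonEdges

G-loopless : Loopless edgesG
G-loopless = from-yes (loopless? edgesG)

H-loopless : Loopless edgesH
H-loopless = from-yes (loopless? edgesH)

G H : Graph
G = fromEdges 8 edgesG G-loopless
H = fromEdges 8 edgesH H-loopless

side : Fin 8 → Bool
side u = toℕ u <ᵇ 4

ψ : Fin 8 → Fin 8
ψ = lift 1 swap₀₁ ∘ lift 5 swap₀₁

ψ-invariant : SumInvariant ψ
ψ-invariant = ∘-invariant (lift-invariant 1 swap₀₁-invariant) (lift-invariant 5 swap₀₁-invariant)

glues03 : ∀ {m} → (Fin 8 → Fin m) → Bool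
glues03 f = does (f (# 3) ≟ f (# 0))

module _ (Y : Graph) (acyclic : Acyclic Y) where

  common-neighbours-glued : ∀ {f : Fin 8 → Vertex Y} → f (# 3) ≢ f (# 0) →
                            EdgeHom Y commonEdges f → f (# 4) ≡ f (# 7)
  common-neighbours-glued f3≢f0 (f04 ∷ _ ∷ _ ∷ f07 ∷ _ ∷ _ ∷ _ ∷ _ ∷ _ ∷ f34 ∷ f37 ∷ []) =
    common-neighbour-unique Y acyclic f3≢f0 f34 (adj-symmetric Y f04) f37 (adj-symmetric Y f07)

  -- ψ maps commonEdges to itself with 1–7 replaced by 2–7, and 1, 2 are both adjacent to 4.
  common-ψ : ∀ {f : Fin 8 → Vertex Y} → f (# 4) ≡ f (# 7) →
             EdgeHom Y commonEdges f ⇔ EdgeHom Y commonEdges (f ∘ ψ)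
  common-ψ {f} f4≡f7 = mk⇔
    (λ { (f04 ∷ f05 ∷ f06 ∷ f07 ∷ f14 ∷ f16 ∷ _ ∷ f24 ∷ f25 ∷ f34 ∷ f37 ∷ []) →
         f04 ∷ f06 ∷ f05 ∷ f07 ∷ f24 ∷ f25 ∷ subst (Adj Y (f (# 2))) f4≡f7 f24
             ∷ f14 ∷ f16 ∷ f34 ∷ f37 ∷ [] })
    (λ { (f04 ∷ f06 ∷ f05 ∷ f07 ∷ f24 ∷ f25 ∷ _ ∷ f14 ∷ f16 ∷ f34 ∷ f37 ∷ []) →
         f04 ∷ f05 ∷ f06 ∷ f07 ∷ f14 ∷ f16 ∷ subst (Adj Y (f (# 1))) f4≡f7 f14
             ∷ f24 ∷ f25 ∷ f34 ∷ f37 ∷ [] })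

  edgeHomH⇔edgeHomG : ∀ {f : Fin 8 → Vertex Y} → f (# 3) ≡ f (# 0) →
                      EdgeHom Y edgesH f ⇔ EdgeHom Y edgesG f
  edgeHomH⇔edgeHomG {f} f3≡f0 = mk⇔
    (λ { (_ ∷ common@(_ ∷ _ ∷ f06 ∷ _)) → subst (λ x → Adj Y x (f (# 6))) (sym f3≡f0) f06 ∷ common })
    (λ { (_ ∷ common@(_ ∷ f05 ∷ _))     → subst (λ x → Adj Y x (f (# 5))) (sym f3≡f0) f05 ∷ common })

  edgeHomH⇔edgeHomGψ : ∀ {f : Fin 8 → Vertex Y} → f (# 3) ≢ f (# 0) →
                       EdgeHom Y edgesH f ⇔ EdgeHom Y edgesG (f ∘ ψ)
  edgeHomH⇔edgeHomGψ f3≢f0 = mk⇔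
    (λ { (f35 ∷ common) → f35 ∷ to   (common-ψ (common-neighbours-glued f3≢f0 common)) common })
    (λ { (f35 ∷ common) → f35 ∷ from (common-ψ (common-neighbours-glued f3≢f0 common)) common })

  isHom-H : ∀ f → isHom H Y f ≡ (if glues03 f then isHom G Y f else isHom G Y (f ∘ ψ))
  isHom-H f with f (# 3) ≟ f (# 0)
  ... | yes f3≡f0 = fromEdges-isHom-≡ H-loopless G-loopless Y f f       (edgeHomH⇔edgeHomG f3≡f0)
  ... | no  f3≢f0 = fromEdges-isHom-≡ H-loopless G-loopless Y f (f ∘ ψ) (edgeHomH⇔edgeHomGψ f3≢f0)

  homCount-G≡H : homCount G Y ≡ homCount H Y
  homCount-G≡H = begin
      homCount G Y
    ≡⟨ length-filter≡∑𝟙 (isHom G Y) maps ⟩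
      ∑ maps (𝟙 ∘ isHom G Y)
    ≡⟨ sym (∑-switch (_∘ ψ) glues03 (isHom G Y) (isHom H Y) maps
                     (ψ-invariant _ ext) (λ _ → refl) isHom-H) ⟩
      ∑ maps (𝟙 ∘ isHom H Y)
    ≡⟨ sym (length-filter≡∑𝟙 (isHom H Y) maps) ⟩
      homCount H Y
    ∎
    where
    open ≡-Reasoning
    maps : List (Fin 8 → Vertex Y)
    maps = allMaps 8 (size Y)

    ext : Extensional (λ f → 𝟙 (not (glues03 f) ∧ isHom G Y f))
    ext f≗g = cong₂ (λ d h → 𝟙 (not d ∧ h)) (cong₂ (λ a b → does (a ≟ b)) (f≗g (# 3)) (f≗g (# 0)))
                    (isHom-cong G Y f≗g)

G-diameter : HasDiameter G 3
G-diameter = hasDiameter3 G (from-yes (all? λ u → all? λ v → ¬? (u ≟ v) →-dec shortRoute? G u v))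
                            (from-yes (farApart? G (# 1) (# 5)))

H-diameter : HasDiameter H 3
H-diameter = hasDiameter3 H (from-yes (all? λ u → all? λ v → ¬? (u ≟ v) →-dec shortRoute? H u v))
                            (from-yes (farApart? H (# 1) (# 5)))

G≇H : ¬ Isomorphic G H
G≇H iso = from-no (lowDegreeEdge? H) (Isomorphic⇒LowDegreeEdge {G} {H} iso (from-yes (lowDegreeEdge? G)))

mainTheorem1 : Σ Graph λ G → Σ Graph λ H →
    Connected G × Connected H × Bipartite G × Bipartite H ×
    HasDiameter G 3 × HasDiameter H 3 × ¬ Isomorphic G H ×
    (∀ (T : Graph) → IsTree T → homCount G T ≡ homCount H T)
mainTheorem1 =
  G , H ,
  diamAtMost⇒connected G (proj₁ G-diameter) , diamAtMost⇒connected H (proj₁ H-diameter) ,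
  (side , from-yes (properColouring? G side)) , (side , from-yes (properColouring? H side)) ,
  G-diameter , H-diameter , G≇H ,
  λ T tree → homCount-G≡H T (proj₂ tree)
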